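{- Let $G$ be a multigraph that admits an interval coloring. Then $w(G)\geq \left\lceil \frac{|V(G)|}{2\,\alpha'(G)}\right\rceil\delta(G)$, where $\alpha'(G)$ is the size of a maximum matching in $G$ and $\delta(G)$ is the minimum degree.
   Context: Multigraphs are finite and may have multiple edges but no loops. For a positive integer $t$, an interval $t$-coloring of a multigraph $G$ is a proper edge coloring $\alpha:E(G)\to\{1,\dots,t\}$ in which every color $1,\dots,t$ is used and, for every vertex $v$, the set of colors on the edges incident to $v$ is an interval of consecutive integers. For a multigraph $G$ having an interval coloring, $w(G)$ denotes the minimum $t$ such that $G$ has an interval $t$-coloring. -}

module Defs where

open import Data.Nat using (ℕ; zero; suc; _+_; _*_; _∸_; _≤_; _<_; _⊓_; NonZero)
open import Data.Nat.DivMod using (_/_)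
open import Data.Fin using (Fin; toℕ)
open import Data.Fin.Properties using (_≟_)
open import Data.Product using (_×_; _,_; proj₁; proj₂; Σ; ∃)
open import Data.Sum using (_⊎_)
open import Data.List using (List; length; filter; foldr; map)
open import Data.List.Base using (allFin)
open import Data.List.Membership.Propositional using (_∈_)
open import Data.List.Relation.Unary.Unique.Propositional using (Unique)
open import Data.Empty using (⊥)
open import Relation.Nullary using (¬_; Dec)
open import Relation.Nullary.Decidable using (_⊎-dec_)
open import Relation.Binary.PropositionalEquality using (_≡_; _≢_)

record Multigraph : Set where
  field
    n    : ℕ
    m    : ℕ
    ends : Fin m → Fin n × Fin n
    loopless : ∀ e → proj₁ (ends e) ≢ proj₂ (ends e)
open Multigraph public

Incident : (G : Multigraph) → Fin (m G) → Fin (n G) → Set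
Incident G e v = (proj₁ (ends G e) ≡ v) ⊎ (proj₂ (ends G e) ≡ v)

incident? : (G : Multigraph) → ∀ e v → Dec (Incident G e v)
incident? G e v = (proj₁ (ends G e) ≟ v) ⊎-dec (proj₂ (ends G e) ≟ v)

degree : (G : Multigraph) → Fin (n G) → ℕ
degree G v = length (filter (λ e → incident? G e v) (allFin (m G)))

-- minimum degree δ(G) (taken to be 0 for the empty graph)
minDeg : Multigraph → ℕ
minDeg G with n G | degree G
... | zero  | _   = 0
... | suc k | deg = foldr _⊓_ (deg Data.Fin.zero) (map deg (allFin (suc k)))

-- Interval t-coloring: colors are 1..t, represented as Fin t (color i ↦ toℕ i + 1).
record IsIntervalColoring (G : Multigraph) (t : ℕ) (c : Fin (m G) → Fin t) : Set where
  field
    positive : 0 < t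
    proper   : ∀ e f v → e ≢ f → Incident G e v → Incident G f v → c e ≢ c f
    allUsed  : ∀ (k : Fin t) → ∃ λ e → c e ≡ k
    interval : ∀ v e f (k : Fin t) → Incident G e v → Incident G f v →
               toℕ (c e) ≤ toℕ k → toℕ k ≤ toℕ (c f) →
               ∃ λ g → Incident G g v × c g ≡ k

HasIntervalColoring : Multigraph → ℕ → Set
HasIntervalColoring G t = Σ (Fin (m G) → Fin t) (IsIntervalColoring G t)

Colorable : Multigraph → Set
Colorable G = ∃ λ t → HasIntervalColoring G t

record IsMatching (G : Multigraph) (M : List (Fin (m G))) : Set where
  field
    unique   : Unique M
    disjoint : ∀ e f v → e ∈ M → f ∈ M → e ≢ f → Incident G e v → Incident G f v → ⊥

IsMatchingNumber : Multigraph → ℕ → Set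
IsMatchingNumber G k =
  (∃ λ M → IsMatching G M × length M ≡ k) ×
  (∀ M → IsMatching G M → length M ≤ k)

-- ⌈ a / b ⌉ for b > 0 (value for b = 0 is an irrelevant junk value 0)
⌈_/_⌉ : ℕ → ℕ → ℕ
⌈ a / zero ⌉ = 0
⌈ a / suc b ⌉ = (a + b) / suc b

-- Put d = δ(G) and cut the colours 0, …, t − 1 into ⌊t/d⌋ consecutive blocks of length d.
-- The colours at a vertex v are d(v) ≥ d distinct integers forming an interval, so they
-- contain the last colour of some block.  Hence the ⌊t/d⌋ colour classes of these last
-- colours, each a matching of at most α'(G) edges, cover all vertices:
-- |V(G)| ≤ ⌊t/d⌋ · 2α'(G), so ⌈|V(G)| / 2α'(G)⌉ · d ≤ ⌊t/d⌋ · d ≤ t.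
module Submission where

open import Defs
open import Data.Nat
open import Data.Nat.Properties
open import Data.Nat.DivMod using (_/_; _%_; m≡m%n+[m/n]*n; m%n<n; m/n*n≤m; m*n/n≡m; /-monoˡ-≤; m<n*o⇒m/o<n)
open import Data.Fin using (Fin; toℕ; fromℕ<)
open import Data.Fin.Properties using (toℕ<n; toℕ-fromℕ<; toℕ-injective)
open import Data.List using (List; []; _∷_; _++_; length; map; filter; concatMap; applyUpTo; upTo; allFin; foldr)
open import Data.List.Properties using (length-++; length-map; length-applyUpTo; length-upTo; length-tabulate)
open import Data.List.Membership.Propositional using (_∈_; lose)
open import Data.List.Membership.Propositional.Properties
  using (∈-∃++; ∈-++⁻; ∈-++⁺ˡ; ∈-++⁺ʳ; ∈-applyUpTo⁺; ∈-upTo⁺; ∈-allFin; ∈-filter⁺; ∈-filter⁻; ∈-concatMap⁺)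
open import Data.List.Relation.Binary.Subset.Propositional using (_⊆_)
open import Data.List.Relation.Unary.Any using (here; there)
open import Data.List.Relation.Unary.All as All using (All; []; _∷_)
open import Data.List.Relation.Unary.All.Properties using (all-filter) renaming (map⁺ to All-map⁺)
open import Data.List.Relation.Unary.AllPairs using ([]; _∷_)
open import Data.List.Relation.Unary.Unique.Propositional using (Unique)
open import Data.List.Relation.Unary.Unique.Propositional.Properties using (filter⁺; allFin⁺)
open import Data.Product using (∃; ∃₂; _×_; _,_; proj₁; proj₂; map₂)
open import Data.Sum using (inj₁; inj₂)
open import Data.Empty using (⊥-elim)
open import Function using (_∘_)
open import Relation.Binary.PropositionalEquality
import Data.List.Extrema

module ℕ-Extrema = Data.List.Extrema ≤-totalOrder

Unique-⊆⇒length≤ : ∀ {a} {A : Set a} {xs ys : List A} → Unique xs → xs ⊆ ys → length xs ≤ length ys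
Unique-⊆⇒length≤ {xs = []} _ _ = z≤n
Unique-⊆⇒length≤ {xs = x ∷ xs} (x∉xs ∷ xs!) xs⊆ys with ∈-∃++ (xs⊆ys (here refl))
... | us , vs , refl = begin
  suc (length xs)             ≤⟨ s≤s (Unique-⊆⇒length≤ xs! xs⊆us++vs) ⟩
  suc (length (us ++ vs))     ≡⟨ cong suc (length-++ us) ⟩
  suc (length us + length vs) ≡⟨ +-suc (length us) (length vs) ⟨
  length us + length (x ∷ vs) ≡⟨ length-++ us ⟨
  length (us ++ x ∷ vs)       ∎
  where
  open ≤-Reasoning
  xs⊆us++vs : xs ⊆ us ++ vs
  xs⊆us++vs {y} y∈xs with ∈-++⁻ us (xs⊆ys (there y∈xs))
  ... | inj₁ y∈us         = ∈-++⁺ˡ y∈us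
  ... | inj₂ (here y≡x)   = ⊥-elim (All.lookup x∉xs y∈xs (sym y≡x))
  ... | inj₂ (there y∈vs) = ∈-++⁺ʳ us y∈vs

Unique-between⇒length≤ : ∀ {a b} {xs : List ℕ} → Unique xs → All (a ≤_) xs → All (_≤ b) xs →
  length xs ≤ suc b ∸ a
Unique-between⇒length≤ {a} {b} {xs} xs! a≤xs xs≤b = begin
  length xs                             ≤⟨ Unique-⊆⇒length≤ xs! xs⊆range ⟩
  length (applyUpTo (a +_) (suc b ∸ a)) ≡⟨ length-applyUpTo (a +_) (suc b ∸ a) ⟩
  suc b ∸ a                             ∎
  where
  open ≤-Reasoning
  xs⊆range : xs ⊆ applyUpTo (a +_) (suc b ∸ a)
  xs⊆range x∈xs = subst (_∈ applyUpTo (a +_) (suc b ∸ a)) (m+[n∸m]≡n a≤x)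
    (∈-applyUpTo⁺ (a +_) (∸-monoˡ-< (s≤s (All.lookup xs≤b x∈xs)) a≤x))
    where a≤x = All.lookup a≤xs x∈xs

Unique-map⁺-on : ∀ {a b p} {A : Set a} {B : Set b} {P : A → Set p} {f : A → B} →
  (∀ {x y} → P x → P y → x ≢ y → f x ≢ f y) →
  ∀ {xs} → All P xs → Unique xs → Unique (map f xs)
Unique-map⁺-on {P = P} {f} f-inj = go
  where
  go : ∀ {xs} → All P xs → Unique xs → Unique (map f xs)
  go [] [] = []
  go (px ∷ pxs) (x∉xs ∷ xs!) = distinct pxs x∉xs ∷ go pxs xs!
    where
    distinct : ∀ {ys} → All P ys → All (_ ≢_) ys → All (f _ ≢_) (map f ys)
    distinct [] [] = []
    distinct (py ∷ pys) (x≢y ∷ x≢ys) = f-inj px py x≢y ∷ distinct pys x≢ys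

length-concatMap≤ : ∀ {a b} {A : Set a} {B : Set b} {f : A → List B} {K : ℕ} →
  (∀ x → length (f x) ≤ K) → ∀ xs → length (concatMap f xs) ≤ length xs * K
length-concatMap≤ f≤K [] = z≤n
length-concatMap≤ {f = f} f≤K (x ∷ xs) = begin
  length (f x ++ concatMap f xs)         ≡⟨ length-++ (f x) ⟩
  length (f x) + length (concatMap f xs) ≤⟨ +-mono-≤ (f≤K x) (length-concatMap≤ f≤K xs) ⟩
  _                                      ∎
  where open ≤-Reasoning

-- The j-th block of d = suc d' colours is [j d, j d + d'].
blockEnd : ℕ → ℕ → ℕ
blockEnd d' j = j * suc d' + d'

blockEnd-between : ∀ d' {a b} → a + d' ≤ b → ∃ λ j → a ≤ blockEnd d' j × blockEnd d' j ≤ b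
blockEnd-between d' {a} {b} a+d'≤b = j , a≤end , end≤b
  where
  j = a / suc d'
  a≤end : a ≤ blockEnd d' j
  a≤end = begin
    a                       ≡⟨ m≡m%n+[m/n]*n a (suc d') ⟩
    a % suc d' + j * suc d' ≤⟨ +-monoˡ-≤ (j * suc d') (s≤s⁻¹ (m%n<n a (suc d'))) ⟩
    d' + j * suc d'         ≡⟨ +-comm d' (j * suc d') ⟩
    blockEnd d' j           ∎
    where open ≤-Reasoning
  end≤b : blockEnd d' j ≤ b
  end≤b = ≤-trans (+-monoˡ-≤ d' (m/n*n≤m a (suc d'))) a+d'≤b

blockEnd<⇒index< : ∀ d' {j t} → blockEnd d' j < t → j < t / suc d'
blockEnd<⇒index< d' {j} {t} end<t = begin-strict
  j                       <⟨ n<1+n j ⟩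
  suc j                   ≡⟨ m*n/n≡m (suc j) (suc d') ⟨
  suc j * suc d' / suc d' ≤⟨ /-monoˡ-≤ (suc d') (subst (_≤ t) (cong suc (+-comm (j * suc d') d')) end<t) ⟩
  t / suc d'              ∎
  where open ≤-Reasoning

⌈/⌉≤ : ∀ {N q} K .{{_ : NonZero K}} → N ≤ q * K → ⌈ N / K ⌉ ≤ q
⌈/⌉≤ {N} {q} (suc K') N≤qK = s≤s⁻¹ (m<n*o⇒m/o<n (begin-strict
  N + K'              <⟨ +-monoʳ-< N (n<1+n K') ⟩
  N + suc K'          ≤⟨ +-monoˡ-≤ (suc K') N≤qK ⟩
  q * suc K' + suc K' ≡⟨ +-comm (q * suc K') (suc K') ⟩
  suc q * suc K'      ∎))
  where open ≤-Reasoning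

edgesAt : (G : Multigraph) → Fin (n G) → List (Fin (m G))
edgesAt G v = filter (λ e → incident? G e v) (allFin (m G))

minDeg≤degree : (G : Multigraph) (v : Fin (n G)) → minDeg G ≤ degree G v
minDeg≤degree record { n = suc _ } v = foldr-⊓≤ (allFin _) (∈-allFin v)
  where
  foldr-⊓≤ : ∀ {a} {A : Set a} {f : A → ℕ} {z} (xs : List A) {y} → y ∈ xs → foldr _⊓_ z (map f xs) ≤ f y
  foldr-⊓≤ {f = f} (x ∷ xs) (here refl)  = m⊓n≤m (f x) _
  foldr-⊓≤ {f = f} (x ∷ xs) (there y∈xs) = ≤-trans (m⊓n≤n (f x) _) (foldr-⊓≤ xs y∈xs)

endpoints : (G : Multigraph) → Fin (m G) → List (Fin (n G))
endpoints G e = proj₁ (ends G e) ∷ proj₂ (ends G e) ∷ []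

∈-endpoints : ∀ (G : Multigraph) {e v} → Incident G e v → v ∈ endpoints G e
∈-endpoints G (inj₁ refl) = here refl
∈-endpoints G (inj₂ refl) = there (here refl)

module _ {G : Multigraph} {t : ℕ} {c : Fin (m G) → Fin t} (ic : IsIntervalColoring G t c) where
  open IsIntervalColoring ic

  colour : Fin (m G) → ℕ
  colour e = toℕ (c e)

  colourClass : ℕ → List (Fin (m G))
  colourClass x = filter (λ e → colour e ≟ x) (allFin (m G))

  colourClass-isMatching : ∀ x → IsMatching G (colourClass x)
  colourClass-isMatching x = record
    { unique   = filter⁺ _ (allFin⁺ (m G))
    ; disjoint = λ e f v e∈ f∈ e≢f ie if →
        proper e f v e≢f ie if (toℕ-injective (trans (hasColour e∈) (sym (hasColour f∈))))
    }
    where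
    hasColour : ∀ {e} → e ∈ colourClass x → colour e ≡ x
    hasColour = proj₂ ∘ ∈-filter⁻ (λ e → colour e ≟ x) {xs = allFin (m G)}

  interval-colour : ∀ {v e f} x → Incident G e v → Incident G f v → colour e ≤ x → x ≤ colour f →
    ∃ λ g → Incident G g v × colour g ≡ x
  interval-colour {v} {e} {f} x ie if e≤x x≤f =
    map₂ (map₂ λ cg≡ → trans (cong toℕ cg≡) toℕ-x)
      (interval v e f (fromℕ< x<t) ie if
        (subst (colour e ≤_) (sym toℕ-x) e≤x) (subst (_≤ colour f) (sym toℕ-x) x≤f))
    where
    x<t = ≤-trans (s≤s x≤f) (toℕ<n (c f))
    toℕ-x = toℕ-fromℕ< x<t

  colours-spread : ∀ {v} d' (es : List (Fin (m G))) → Unique es → All (λ e → Incident G e v) es →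
    suc d' ≤ length es → ∃₂ λ e f → Incident G e v × Incident G f v × colour e + d' ≤ colour f
  colours-spread {v} d' (e₀ ∷ es) es! (i₀ ∷ is) d≤len =
    argmin colour e₀ es , argmax colour e₀ es , argmin-all colour i₀ is , argmax-all colour i₀ is , spread
    where
    open ℕ-Extrema
    a = colour (argmin colour e₀ es)
    b = colour (argmax colour e₀ es)
    a≤ : All (λ e → a ≤ colour e) (e₀ ∷ es)
    a≤ = f[argmin]≤f[⊤] {f = colour} e₀ es ∷ f[argmin]≤f[xs] {f = colour} e₀ es
    ≤b : All (λ e → colour e ≤ b) (e₀ ∷ es)
    ≤b = f[⊥]≤f[argmax] {f = colour} e₀ es ∷ f[xs]≤f[argmax] {f = colour} e₀ es
    distinct : Unique (map colour (e₀ ∷ es))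
    distinct = Unique-map⁺-on (λ ie if e≢f → proper _ _ v e≢f ie if ∘ toℕ-injective) (i₀ ∷ is) es!
    d≤width : suc d' ≤ suc b ∸ a
    d≤width = ≤-trans d≤len (subst (_≤ suc b ∸ a) (length-map colour (e₀ ∷ es))
                (Unique-between⇒length≤ distinct (All-map⁺ a≤) (All-map⁺ ≤b)))
    spread : a + d' ≤ b
    spread = subst (_≤ b) (+-comm d' a)
               (s≤s⁻¹ (m≤o∸n⇒m+n≤o (suc d') (m≤n⇒m≤1+n (≤-trans (All.head a≤) (All.head ≤b))) d≤width))

  sees-blockEnd : ∀ d' v → suc d' ≤ degree G v →
    ∃ λ j → j < t / suc d' × ∃ λ g → Incident G g v × colour g ≡ blockEnd d' j
  sees-blockEnd d' v d≤deg
    with e , f , ie , if , spread ←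
           colours-spread d' (edgesAt G v) (filter⁺ _ (allFin⁺ (m G))) (all-filter _ (allFin (m G))) d≤deg
    with j , e≤end , end≤f ← blockEnd-between d' spread
    = j , blockEnd<⇒index< d' (≤-trans (s≤s end≤f) (toℕ<n (c f))) , interval-colour (blockEnd d' j) ie if e≤end end≤f

  order≤[t/d]*2k : ∀ d' k → (∀ M → IsMatching G M → length M ≤ k) →
    (∀ v → suc d' ≤ degree G v) → n G ≤ t / suc d' * (2 * k)
  order≤[t/d]*2k d' k matching≤k d≤deg = begin
    n G                                   ≡⟨ length-tabulate {n = n G} (λ v → v) ⟨
    length (allFin (n G))                 ≤⟨ Unique-⊆⇒length≤ (allFin⁺ (n G)) covered ⟩
    length (concatMap classEnds (upTo q)) ≤⟨ length-concatMap≤ classEnds≤ (upTo q) ⟩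
    length (upTo q) * (k * 2)             ≡⟨ cong₂ _*_ (length-upTo q) (*-comm k 2) ⟩
    q * (2 * k)                           ∎
    where
    open ≤-Reasoning
    q = t / suc d'
    classEnds : ℕ → List (Fin (n G))
    classEnds j = concatMap (endpoints G) (colourClass (blockEnd d' j))
    classEnds≤ : ∀ j → length (classEnds j) ≤ k * 2
    classEnds≤ j = ≤-trans (length-concatMap≤ (λ _ → ≤-refl) (colourClass (blockEnd d' j)))
                     (*-monoˡ-≤ 2 (matching≤k _ (colourClass-isMatching (blockEnd d' j))))
    covered : allFin (n G) ⊆ concatMap classEnds (upTo q)
    covered {v} _ with j , j<q , g , ig , cg ← sees-blockEnd d' v (d≤deg v) =
      ∈-concatMap⁺ classEnds (lose (∈-upTo⁺ j<q)
        (∈-concatMap⁺ (endpoints G) (lose (∈-filter⁺ (λ e → colour e ≟ _) (∈-allFin g) cg) (∈-endpoints G ig))))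

mainTheorem16 : (G : Multigraph) → Colorable G →
    (k : ℕ) → .{{_ : NonZero k}} → IsMatchingNumber G k →
    (t : ℕ) → HasIntervalColoring G t →
    ⌈ n G / (2 * k) ⌉ * minDeg G ≤ t
mainTheorem16 G _ k@(suc _) (_ , matching≤k) t (c , ic) with minDeg G | minDeg≤degree G
... | zero   | _     = subst (_≤ t) (sym (*-zeroʳ ⌈ n G / (2 * k) ⌉)) z≤n
... | suc d' | δ≤deg = begin
  ⌈ n G / (2 * k) ⌉ * suc d' ≤⟨ *-monoˡ-≤ (suc d') ⌈n/2k⌉≤[t/d] ⟩
  t / suc d' * suc d'        ≤⟨ m/n*n≤m t (suc d') ⟩
  t                          ∎
  where
  open ≤-Reasoning
  ⌈n/2k⌉≤[t/d] : ⌈ n G / (2 * k) ⌉ ≤ t / suc d'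
  ⌈n/2k⌉≤[t/d] = ⌈/⌉≤ (2 * k) (order≤[t/d]*2k ic d' k matching≤k δ≤deg)
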